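{- Let $(W,R)$ be a frame with $R^*=W\times W$. Then $G_k(w)=G_k(v)$ for all $k>0$ and all $w,v\in W$.
   Context: $R^*$ is the reflexive transitive closure of $R$. A path in $(W,R)$ is a finite nonempty sequence $w_0\dots w_n$ with $w_iRw_{i+1}$ for $i<n$; its length is $n$. A path with $w_0=w_n$ is a $w_0$-loop (a one-element sequence is a loop of length $0$). For $w\in W$ and $k>0$, $G_k(w)$ is the set of remainders modulo $k$ of lengths of $w$-loops. -}

module Defs where

open import Level using (Level; _⊔_)
open import Data.Nat using (ℕ; zero; suc; _%_; NonZero)
open import Data.Product using (Σ; ∃; _×_)
open import Relation.Binary.PropositionalEquality using (_≡_)
open import Relation.Binary.Construct.Closure.ReflexiveTransitive using (Star)

data Path {a ℓ} {W : Set a} (R : W → W → Set ℓ) : W → W → ℕ → Set (a ⊔ ℓ) where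
  [_]  : (w : W) → Path R w w zero
  _∷_  : ∀ {w u v n} → R w u → Path R u v n → Path R w v (suc n)

IsLoopLength : ∀ {a ℓ} {W : Set a} (R : W → W → Set ℓ) → W → ℕ → Set (a ⊔ ℓ)
IsLoopLength R w n = Path R w w n

G : ∀ {a ℓ} {W : Set a} (R : W → W → Set ℓ) (k : ℕ) .{{_ : NonZero k}} → W → ℕ → Set (a ⊔ ℓ)
G R k w r = ∃ λ n → IsLoopLength R w n × n % k ≡ r

StarTotal : ∀ {a ℓ} {W : Set a} (R : W → W → Set ℓ) → Set (a ⊔ ℓ)
StarTotal {W = W} R = (w v : W) → Star R w v

-- A w-loop L of length n transfers to v: with paths p : v ⇝ w of length a and
-- q : w ⇝ v of length b (given by R* = W × W), the v-loop p L q followed by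
-- k − 1 further copies of the v-loop p q has length n + k (a + b) ≡ n (mod k).
module Submission where

open import Defs
open import Data.Nat using (ℕ; NonZero; zero; suc; _+_; _*_; _%_)
open import Data.Nat.DivMod using ([m+kn]%n≡m%n)
open import Data.Product using (_×_; _,_; ∃)
open import Relation.Binary.PropositionalEquality using (_≡_; refl; trans; subst)
open import Relation.Binary.Construct.Closure.ReflexiveTransitive using (Star; ε; _◅_)
open import Data.Nat.Solver using (module +-*-Solver)
open +-*-Solver using (solve; _:+_; _:*_; _:=_; con)

module _ {a ℓ} {W : Set a} {R : W → W → Set ℓ} where

  star⇒path : ∀ {x y} → Star R x y → ∃ (Path R x y)
  star⇒path ε = _ , [ _ ]
  star⇒path (r ◅ s) with star⇒path s
  ... | n , p = suc n , r ∷ p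

  _++_ : ∀ {x y z m n} → Path R x y m → Path R y z n → Path R x z (m + n)
  [ _ ] ++ q = q
  (r ∷ p) ++ q = r ∷ (p ++ q)

  replicate : ∀ {x c} (m : ℕ) → Path R x x c → Path R x x (m * c)
  replicate zero    p = [ _ ]
  replicate (suc m) p = p ++ replicate m p

  conjugate-loop : ∀ {v w a b n} (j : ℕ) → Path R v w a → Path R w v b →
                   IsLoopLength R w n → IsLoopLength R v (n + (a + b) * suc j)
  conjugate-loop {v} {a = a} {b} {n} j p q L =
    subst (Path R v v) length-eq (((p ++ L) ++ q) ++ replicate j (p ++ q))
    where
    length-eq : ((a + n) + b) + j * (a + b) ≡ n + (a + b) * suc j
    length-eq = solve 4 (λ a n b j → ((a :+ n) :+ b) :+ j :* (a :+ b)
                                   := n :+ (a :+ b) :* (con 1 :+ j)) refl a n b j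

  G-transfer : StarTotal R → (k : ℕ) .{{_ : NonZero k}} → (w v : W) → (r : ℕ) →
               G R k w r → G R k v r
  G-transfer total (suc j) w v r (n , L , n%k≡r)
    with star⇒path (total v w) | star⇒path (total w v)
  ... | a , p | b , q =
    n + (a + b) * suc j , conjugate-loop j p q L ,
    trans ([m+kn]%n≡m%n n (a + b) (suc j)) n%k≡r

proposition7 : ∀ {a ℓ} {W : Set a} (R : W → W → Set ℓ) → StarTotal R →
    (k : ℕ) .{{_ : NonZero k}} → (w v : W) → (r : ℕ) →
    (G R k w r → G R k v r) × (G R k v r → G R k w r)
proposition7 R total k w v r = G-transfer total k w v r , G-transfer total k v w r
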